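{- Let $G$ have maximum degree $\Delta$, fix an almost-clique decomposition with parameter $\varepsilon\in(0,1/20)$ and a choice of picked special nodes as described in the context, and let $\psi=\Delta^{1/3}$. For any ordinary almost-clique $C$ with $|C|\ge\Delta-\psi$, there exists a matching of size $\Omega(\psi)$ in the bipartite graph between $N(C)\setminus C$ and $C$ (consisting of the edges of $G$ with one endpoint in each side).
   Context: Almost-clique decomposition (ACD) with parameter $\varepsilon$: a partition of $V$ into $V_{sparse}$ and almost-cliques $C_1,\dots,C_t$ such that each $C_i$ has $(1-\varepsilon)\Delta\le|C_i|\le(1+3\varepsilon)\Delta$, every $v\in C_i$ has $|N(v)\cap C_i|\ge(1-4\varepsilon)\Delta$, every $u\notin C_i$ has $|N(u)\cap C_i|\le(1-2\varepsilon)\Delta$, and nodes of $V_{sparse}$ have sparsity $\Omega(\varepsilon^2\Delta)$. $N(C)=\bigcup_{v\in C}N(v)$. Let $\psi=\Delta^{1/3}$, $\phi=\Delta^{2/3}/2$. A node $v\notin C$ is special for almost-clique $C$ if it has at least $\phi$ neighbors in $C$. A node is simplicial if its neighborhood is a clique. An almost-clique is easy if it contains a simplicial node or two non-adjacent vertices. An almost-clique $C$ is difficult if it is not easy, has a special node, and $|C|\ge\Delta-\psi$; for each difficult almost-clique one special node is picked (arbitrarily, fixed). An almost-clique is nice if it is easy or contains a node picked by some difficult almost-clique. An almost-clique is ordinary if it is neither difficult nor nice.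
   Formalization: The parameter ε of the almost-clique decomposition is rational. -}

module Defs where

open import Data.Nat as ℕ using (ℕ; _≤_; _*_; _∸_)
open import Data.Integer using (+_)
open import Data.Rational as ℚ using (ℚ; 0ℚ; 1ℚ)
open import Data.Bool using (Bool; true; false; _∧_)
open import Data.Fin using (Fin)
open import Data.Fin.Subset using (Subset; _∈_; _∉_; _∩_; ∁; ∣_∣)
open import Data.Vec using (tabulate; lookup)
open import Data.List using (allFin; map)
open import Data.Bool.ListAction using (any)
open import Data.Nat.ListAction using (sum)
open import Data.Product using (Σ; ∃; _×_)
open import Data.Sum using (_⊎_)
open import Relation.Nullary using (¬_)
open import Relation.Binary.PropositionalEquality using (_≡_; _≢_)

⟦_⟧ : ℕ → ℚ
⟦ k ⟧ = (+ k) ℚ./ 1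

record Graph (n : ℕ) : Set where
  field
    adj     : Fin n → Fin n → Bool
    sym     : ∀ u v → adj u v ≡ adj v u
    irrefl  : ∀ v → adj v v ≡ false
open Graph public

module _ {n : ℕ} (G : Graph n) where

  N : Fin n → Subset n
  N v = tabulate (λ u → adj G v u)

  deg : Fin n → ℕ
  deg v = ∣ N v ∣

  MaxDegree : ℕ → Set
  MaxDegree Δ = (∀ v → deg v ≤ Δ) × ∃ λ v → deg v ≡ Δ

  NC : Subset n → Subset n
  NC C = tabulate (λ u → any (λ v → lookup C v ∧ adj G v u) (allFin n))

  -- number of ordered pairs (u,w) of adjacent vertices inside S (= 2 |E(G[S])|)
  orderedEdges : Subset n → ℕ
  orderedEdges S = sum (map (λ u → if-in u) (allFin n))
    where
      if-in : Fin n → ℕ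
      if-in u with lookup S u
      ... | true  = ∣ N u ∩ S ∣
      ... | false = 0

  -- Δ · ζ_v = (Δ choose 2) - |E(G[N(v)])|   (ζ_v = sparsity of v)
  Δtimessparsity : ℕ → Fin n → ℚ
  Δtimessparsity Δ v =
    (⟦ Δ * (Δ ∸ 1) ⟧ ℚ.- ⟦ orderedEdges (N v) ⟧) ℚ.* ((+ 1) ℚ./ 2)

  -- almost-clique decomposition with parameter ε; sparse nodes have sparsity
  -- at least cs · ε² · Δ  (cs is the constant hidden in Ω(ε²Δ))
  record ACD (Δ : ℕ) (ε cs : ℚ) : Set where
    field
      Vsparse : Subset n
      t       : ℕ
      Cl      : Fin t → Subset n
      partition : ∀ v →
        (v ∈ Vsparse × (∀ i → v ∉ Cl i))
        ⊎ (v ∉ Vsparse × Σ (Fin t) λ i → v ∈ Cl i × (∀ j → v ∈ Cl j → j ≡ i))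
      size-lo : ∀ i → (1ℚ ℚ.- ε) ℚ.* ⟦ Δ ⟧ ℚ.≤ ⟦ ∣ Cl i ∣ ⟧
      size-hi : ∀ i → ⟦ ∣ Cl i ∣ ⟧ ℚ.≤ (1ℚ ℚ.+ ⟦ 3 ⟧ ℚ.* ε) ℚ.* ⟦ Δ ⟧
      inside  : ∀ i v → v ∈ Cl i →
                (1ℚ ℚ.- ⟦ 4 ⟧ ℚ.* ε) ℚ.* ⟦ Δ ⟧ ℚ.≤ ⟦ ∣ N v ∩ Cl i ∣ ⟧
      outside : ∀ i u → u ∉ Cl i →
                ⟦ ∣ N u ∩ Cl i ∣ ⟧ ℚ.≤ (1ℚ ℚ.- ⟦ 2 ⟧ ℚ.* ε) ℚ.* ⟦ Δ ⟧
      sparse  : ∀ v → v ∈ Vsparse →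
                cs ℚ.* ε ℚ.* ε ℚ.* ⟦ Δ ⟧ ℚ.* ⟦ Δ ⟧ ℚ.≤ Δtimessparsity Δ v

  -- v ∉ C is special for C: at least φ = Δ^{2/3}/2 neighbours in C,
  -- i.e. Δ² ≤ (2 · |N(v) ∩ C|)³
  Special : ℕ → Subset n → Fin n → Set
  Special Δ C v = v ∉ C × Δ * Δ ≤ (2 * ∣ N v ∩ C ∣) * (2 * ∣ N v ∩ C ∣) * (2 * ∣ N v ∩ C ∣)

  Simplicial : Fin n → Set
  Simplicial v = ∀ u w → u ∈ N v → w ∈ N v → u ≢ w → adj G u w ≡ true

  Easy : Subset n → Set
  Easy C = (Σ (Fin n) λ v → v ∈ C × Simplicial v)
         ⊎ (Σ (Fin n) λ u → Σ (Fin n) λ w → u ∈ C × w ∈ C × u ≢ w × adj G u w ≡ false)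

  -- |C| ≥ Δ - ψ with ψ = Δ^{1/3}, i.e. (Δ ∸ |C|)³ ≤ Δ
  LargeC : ℕ → Subset n → Set
  LargeC Δ C = (Δ ∸ ∣ C ∣) * (Δ ∸ ∣ C ∣) * (Δ ∸ ∣ C ∣) ≤ Δ

  Difficult : ℕ → Subset n → Set
  Difficult Δ C = ¬ Easy C × (Σ (Fin n) λ v → Special Δ C v) × LargeC Δ C

  module _ {Δ : ℕ} {ε cs : ℚ} (D : ACD Δ ε cs) where
    open ACD D

    Picking : (Fin t → Fin n) → Set
    Picking pick = ∀ i → Difficult Δ (Cl i) → Special Δ (Cl i) (pick i)

    Nice : (Fin t → Fin n) → Fin t → Set
    Nice pick j = Easy (Cl j)
                ⊎ (Σ (Fin t) λ i → Difficult Δ (Cl i) × pick i ∈ Cl j)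

    Ordinary : (Fin t → Fin n) → Fin t → Set
    Ordinary pick j = ¬ Difficult Δ (Cl j) × ¬ Nice pick j

  record BipMatching (A B : Subset n) (m : ℕ) : Set where
    field
      left  : Fin m → Fin n
      right : Fin m → Fin n
      left∈  : ∀ k → left k ∈ A
      right∈ : ∀ k → right k ∈ B
      edge   : ∀ k → adj G (left k) (right k) ≡ true
      left-inj  : ∀ k l → left k ≡ left l → k ≡ l
      right-inj : ∀ k l → right k ≡ right l → k ≡ l

-- As C is not easy it is a clique without simplicial
-- nodes, so every v ∈ C has a neighbour exit(v) outside C. As C is large but not difficult,
-- no node outside C is special: each has fewer than φ = Δ^{2/3}/2 neighbours in C. Choosing
-- one v per value of exit gives a matching whose m outer endpoints together see all of C,
-- hence Δ/2 ≤ |C| < m·φ and m > Δ^{1/3} = ψ.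
module Submission where

module OrdinaryMatching where
  open import Defs hiding (sym)
  open import Data.Bool using (Bool; true; false; T; _∧_)
  open import Data.Bool.Properties using (T-≡) renaming (_≟_ to _≟ᵇ_)
  open import Data.Empty using (⊥-elim)
  open import Data.Fin using (Fin; zero; suc)
  open import Data.Fin.Properties using (any?) renaming (_≟_ to _≟ᶠ_)
  open import Data.Fin.Subset using (Subset; _∈_; _∉_; _⊆_; _∩_; _∪_; ∁; ⋃; ∣_∣)
  open import Data.Fin.Subset.Properties
    using (_∈?_; ∣⊥∣≡0; x∈p∪q⁺; x∈p∩q⁺; x∉p⇒x∈∁p; p⊆q⇒∣p∣≤∣q∣)
  open import Data.List using (List; []; _∷_; length; allFin)
  import Data.List as List
  open import Data.List.Extrema.Nat using (max; xs≤max; argmax-all)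
  open import Data.List.Membership.Propositional using (lose) renaming (_∈_ to _∈ₗ_)
  open import Data.List.Membership.Propositional.Properties using (∈-allFin)
  open import Data.List.Properties using (length-tabulate)
  open import Data.List.Relation.Unary.All using (All; []; _∷_)
  import Data.List.Relation.Unary.All.Properties as All
  open import Data.List.Relation.Unary.Any using (Any; here; there)
  import Data.List.Relation.Unary.Any.Properties as Any
  open import Data.Maybe using (Maybe; just; nothing)
  import Data.Maybe as Maybe
  open import Data.Maybe.Properties using (just-injective)
  open import Data.Nat using (ℕ; suc; _+_; _*_; _∸_; _≤_; _<_; _≤?_; z≤n; s≤s)
  open import Data.Nat.Properties
  open import Data.Nat.Tactic.RingSolver using (solve-∀)
  open import Data.Product using (Σ; ∃; _×_; _,_; proj₁; proj₂)
  open import Data.Sum using (inj₁; inj₂)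
  open import Data.Unit using (tt)
  open import Data.Vec using ([]; _∷_; lookup; tabulate)
  open import Data.Vec.Properties using (lookup∘tabulate; []=⇒lookup; lookup⇒[]=)
  open import Function using (Equivalence; Injective; id)
  open import Relation.Binary.Definitions using (DecidableEquality)
  open import Relation.Binary.PropositionalEquality
  open import Relation.Nullary using (¬_; yes; no; contradiction)
  open import Relation.Nullary.Decidable using (Dec; _×-dec_; ¬?; decidable-stable; dec⇒maybe)

  cube : ℕ → ℕ
  cube m = m * m * m

  cube-mono-≤ : ∀ {m n} → m ≤ n → cube m ≤ cube n
  cube-mono-≤ m≤n = *-mono-≤ (*-mono-≤ m≤n m≤n) m≤n

  cube-*-distrib : ∀ m n → (m * n) * (m * n) * (m * n) ≡ (m * m * m) * (n * n * n)
  cube-*-distrib = solve-∀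

  2*c<Δ⇒Δ<2*[Δ∸c] : ∀ {Δ c} → 2 * c < Δ → Δ < 2 * (Δ ∸ c)
  2*c<Δ⇒Δ<2*[Δ∸c] {Δ} {c} 2c<Δ = begin-strict
      Δ                  ≡⟨ Δ≡c+d ⟩
      c + d              <⟨ +-monoˡ-< d c<d ⟩
      d + d              ≡⟨ cong (d +_) (sym (+-identityʳ d)) ⟩
      2 * d              ∎
    where
      open ≤-Reasoning
      d = Δ ∸ c
      c+c<Δ : c + c < Δ
      c+c<Δ = subst (_< Δ) (cong (c +_) (+-identityʳ c)) 2c<Δ
      Δ≡c+d : Δ ≡ c + d
      Δ≡c+d = sym (m+[n∸m]≡n (≤-trans (m≤m+n c c) (<⇒≤ c+c<Δ)))
      c<d : c < d
      c<d = +-cancelˡ-< c c d (subst (c + c <_) Δ≡c+d c+c<Δ)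

  8*n<[1+n]³ : ∀ {n} → 2 ≤ n → 8 * n < cube (suc n)
  8*n<[1+n]³ {n} 2≤n = begin-strict
      8 * n              ≤⟨ *-monoˡ-≤ n (n≤1+n 8) ⟩
      9 * n              <⟨ *-monoʳ-< 9 (n<1+n n) ⟩
      9 * suc n          ≤⟨ *-monoˡ-≤ (suc n) (*-mono-≤ (s≤s 2≤n) (s≤s 2≤n)) ⟩
      cube (suc n)       ∎
    where open ≤-Reasoning

  large⇒Δ≤2*c : ∀ {Δ} c → 2 ≤ Δ → cube (Δ ∸ c) ≤ Δ → Δ ≤ 2 * c
  large⇒Δ≤2*c {Δ} c 2≤Δ d³≤Δ with Δ ≤? 2 * c
  ... | yes Δ≤2c = Δ≤2c
  ... | no Δ≰2c = contradiction (begin-strict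
      cube (suc Δ)       ≤⟨ cube-mono-≤ (2*c<Δ⇒Δ<2*[Δ∸c] {Δ} {c} (≰⇒> Δ≰2c)) ⟩
      cube (2 * d)       ≡⟨ cube-*-distrib 2 d ⟩
      8 * cube d         ≤⟨ *-monoʳ-≤ 8 d³≤Δ ⟩
      8 * Δ              <⟨ 8*n<[1+n]³ 2≤Δ ⟩
      cube (suc Δ)       ∎) (<-irrefl refl)
    where
      open ≤-Reasoning
      d = Δ ∸ c

  Δ≤m*b⇒Δ≤m³ : ∀ {Δ} m b → Δ ≤ m * b → cube b < Δ * Δ → Δ ≤ cube m
  Δ≤m*b⇒Δ≤m³ {Δ} m b Δ≤mb b³<Δ² with Δ ≤? cube m
  ... | yes Δ≤m³ = Δ≤m³
  ... | no Δ≰m³ = contradiction (begin-strict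
      cube Δ             ≤⟨ cube-mono-≤ Δ≤mb ⟩
      cube (m * b)       ≡⟨ cube-*-distrib m b ⟩
      cube m * cube b    <⟨ *-mono-< (≰⇒> Δ≰m³) b³<Δ² ⟩
      Δ * (Δ * Δ)        ≡⟨ sym (*-assoc Δ Δ Δ) ⟩
      cube Δ             ∎) (<-irrefl refl)
    where open ≤-Reasoning

  ∣p∪q∣≤∣p∣+∣q∣ : ∀ {n} (p q : Subset n) → ∣ p ∪ q ∣ ≤ ∣ p ∣ + ∣ q ∣
  ∣p∪q∣≤∣p∣+∣q∣ []          []          = z≤n
  ∣p∪q∣≤∣p∣+∣q∣ (true ∷ p)  (true ∷ q)  = s≤s (≤-trans (∣p∪q∣≤∣p∣+∣q∣ p q) (+-monoʳ-≤ ∣ p ∣ (n≤1+n ∣ q ∣)))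
  ∣p∪q∣≤∣p∣+∣q∣ (true ∷ p)  (false ∷ q) = s≤s (∣p∪q∣≤∣p∣+∣q∣ p q)
  ∣p∪q∣≤∣p∣+∣q∣ (false ∷ p) (true ∷ q)  = subst (suc ∣ p ∪ q ∣ ≤_) (sym (+-suc ∣ p ∣ ∣ q ∣)) (s≤s (∣p∪q∣≤∣p∣+∣q∣ p q))
  ∣p∪q∣≤∣p∣+∣q∣ (false ∷ p) (false ∷ q) = ∣p∪q∣≤∣p∣+∣q∣ p q

  ∣⋃ps∣≤length*b : ∀ {n b} {ps : List (Subset n)} → All (λ p → ∣ p ∣ ≤ b) ps → ∣ ⋃ ps ∣ ≤ length ps * b
  ∣⋃ps∣≤length*b {n} [] = ≤-reflexive (∣⊥∣≡0 n)
  ∣⋃ps∣≤length*b {ps = p ∷ ps} (∣p∣≤b ∷ bounded) =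
    ≤-trans (∣p∪q∣≤∣p∣+∣q∣ p (⋃ ps)) (+-mono-≤ ∣p∣≤b (∣⋃ps∣≤length*b bounded))

  x∈⋃⁺ : ∀ {n} {x : Fin n} {ps : List (Subset n)} → Any (x ∈_) ps → x ∈ ⋃ ps
  x∈⋃⁺ (here x∈p)  = x∈p∪q⁺ (inj₁ x∈p)
  x∈⋃⁺ (there x∈⋃) = x∈p∪q⁺ (inj₂ (x∈⋃⁺ x∈⋃))

  ∈-tabulate⁺ : ∀ {n} {f : Fin n → Bool} {x} → f x ≡ true → x ∈ tabulate f
  ∈-tabulate⁺ {f = f} {x} fx = lookup⇒[]= x _ (trans (lookup∘tabulate f x) fx)

  ∈-tabulate⁻ : ∀ {n} {f : Fin n → Bool} {x} → x ∈ tabulate f → f x ≡ true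
  ∈-tabulate⁻ {f = f} {x} x∈ = trans (sym (lookup∘tabulate f x)) ([]=⇒lookup x∈)

  record Transversal {A B : Set} (f : A → Maybe B) (xs : List A) : Set where
    field
      size            : ℕ
      image           : Fin size → B
      preimage        : Fin size → A
      maps            : ∀ k → f (preimage k) ≡ just (image k)
      image-injective : Injective _≡_ _≡_ image
      image-complete  : ∀ {x b} → x ∈ₗ xs → f x ≡ just b → ∃ λ k → image k ≡ b

    preimage-injective : Injective _≡_ _≡_ preimage
    preimage-injective {k} {l} same = image-injective (just-injective (begin
        just (image k)   ≡⟨ sym (maps k) ⟩
        f (preimage k)   ≡⟨ cong f same ⟩
        f (preimage l)   ≡⟨ maps l ⟩
        just (image l)   ∎))
      where open ≡-Reasoning

  module _ {A B : Set} (f : A → Maybe B) (_≟_ : DecidableEquality B) where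

    private
      keep : ∀ {x xs} (T : Transversal f xs) →
             (∀ {b} → f x ≡ just b → ∃ λ k → Transversal.image T k ≡ b) → Transversal f (x ∷ xs)
      keep T complete-at-x = record
        { Transversal T hiding (image-complete)
        ; image-complete = λ where
            (here refl)  fx → complete-at-x fx
            (there x∈xs) fx → Transversal.image-complete T x∈xs fx
        }

      add : ∀ {x xs b} (T : Transversal f xs) → f x ≡ just b →
            (∀ k → Transversal.image T k ≢ b) → Transversal f (x ∷ xs)
      add {x} {xs} {b} T fx≡b new = record
        { size            = suc size
        ; image           = image′
        ; preimage        = preimage′
        ; maps            = maps′
        ; image-injective = injective′
        ; image-complete  = complete′
        }
        where
          open Transversal T
          image′ : Fin (suc size) → B
          image′ zero    = b
          image′ (suc k) = image k
          preimage′ : Fin (suc size) → A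
          preimage′ zero    = x
          preimage′ (suc k) = preimage k
          maps′ : ∀ k → f (preimage′ k) ≡ just (image′ k)
          maps′ zero    = fx≡b
          maps′ (suc k) = maps k
          injective′ : Injective _≡_ _≡_ image′
          injective′ {zero}  {zero}  _  = refl
          injective′ {zero}  {suc l} eq = contradiction (sym eq) (new l)
          injective′ {suc k} {zero}  eq = contradiction eq (new k)
          injective′ {suc k} {suc l} eq = cong suc (image-injective eq)
          complete′ : ∀ {y c} → y ∈ₗ x ∷ xs → f y ≡ just c → ∃ λ k → image′ k ≡ c
          complete′ (here refl)  fy = zero , just-injective (trans (sym fx≡b) fy)
          complete′ (there y∈xs) fy with image-complete y∈xs fy
          ... | k , eq = suc k , eq

    transversal : (xs : List A) → Transversal f xs
    transversal [] = record
      { size = 0 ; image = λ () ; preimage = λ () ; maps = λ ()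
      ; image-injective = λ { {()} } ; image-complete = λ () }
    transversal (x ∷ xs) with f x in fx | transversal xs
    ... | nothing | T = keep T λ fx≡b → contradiction (trans (sym fx) fx≡b) λ ()
    ... | just b  | T with any? (λ k → Transversal.image T k ≟ b)
    ...   | yes (k , eq) = keep T λ fx≡c → k , trans eq (just-injective (trans (sym fx) fx≡c))
    ...   | no fresh     = add T fx (λ k eq → fresh (k , eq))

  module _ {n : ℕ} (G : Graph n) (C : Subset n) where

    adj⇒∈N : ∀ {v u} → adj G v u ≡ true → u ∈ N G v
    adj⇒∈N = ∈-tabulate⁺

    ∈N⇒adj : ∀ {v u} → u ∈ N G v → adj G v u ≡ true
    ∈N⇒adj = ∈-tabulate⁻

    Leaving : Fin n → Fin n → Set
    Leaving v u = v ∈ C × u ∉ C × adj G v u ≡ true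

    leaving? : ∀ v u → Dec (Leaving v u)
    leaving? v u = v ∈? C ×-dec ¬? (u ∈? C) ×-dec (adj G v u ≟ᵇ true)

    leaving⇒∈NC : ∀ {v u} → Leaving v u → u ∈ NC G C
    leaving⇒∈NC {v} {u} (v∈C , _ , vu) = ∈-tabulate⁺
      (Equivalence.to T-≡ (Any.any⁺ _ (lose (∈-allFin v) edge-from-C)))
      where
        edge-from-C : T (lookup C v ∧ adj G v u)
        edge-from-C rewrite []=⇒lookup v∈C | vu = tt

    exit : Fin n → Maybe (Fin n)
    exit v = Maybe.map proj₁ (dec⇒maybe (any? (leaving? v)))

    exit-sound : ∀ {v u} → exit v ≡ just u → Leaving v u
    exit-sound {v} eq with any? (leaving? v)
    exit-sound refl | yes (_ , leaves) = leaves

    notEasy⇒clique : ¬ Easy G C → ∀ {a b} → a ∈ C → b ∈ C → a ≢ b → adj G a b ≡ true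
    notEasy⇒clique notEasy {a} {b} a∈C b∈C a≢b with adj G a b in ab
    ... | true  = refl
    ... | false = ⊥-elim (notEasy (inj₂ (a , b , a∈C , b∈C , a≢b , ab)))

    -- A node of C without exit would be simplicial, as its neighbourhood lies in the clique C.
    notEasy⇒exit : ¬ Easy G C → ∀ {v} → v ∈ C → ∃ λ u → exit v ≡ just u
    notEasy⇒exit notEasy {v} v∈C with any? (leaving? v)
    ... | yes (u , _) = u , refl
    ... | no noExit   = ⊥-elim (notEasy (inj₁ (v , v∈C , simplicial)))
      where
        N⊆C : N G v ⊆ C
        N⊆C {a} a∈N = decidable-stable (a ∈? C) λ a∉C → noExit (a , v∈C , a∉C , ∈N⇒adj a∈N)
        simplicial : Simplicial G v
        simplicial a b a∈N b∈N = notEasy⇒clique notEasy (N⊆C a∈N) (N⊆C b∈N)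

    module _ (E : Transversal exit (allFin n)) where
      open Transversal E

      image-outside : ∀ k → image k ∉ C
      image-outside k = proj₁ (proj₂ (exit-sound (maps k)))

      transversal⇒matching : BipMatching G (NC G C ∩ ∁ C) C size
      transversal⇒matching = record
        { left      = image
        ; right     = preimage
        ; left∈     = λ k → x∈p∩q⁺ (leaving⇒∈NC (leaves k) , x∉p⇒x∈∁p (image-outside k))
        ; right∈    = λ k → proj₁ (leaves k)
        ; edge      = λ k → trans (Graph.sym G (image k) (preimage k)) (proj₂ (proj₂ (leaves k)))
        ; left-inj  = λ k l → image-injective
        ; right-inj = λ k l → preimage-injective
        }
        where
          leaves : ∀ k → Leaving (preimage k) (image k)
          leaves k = exit-sound (maps k)

      seen : Fin size → Subset n
      seen k = N G (image k) ∩ C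

      Seen : List (Subset n)
      Seen = List.tabulate seen

      notEasy⇒C⊆⋃Seen : ¬ Easy G C → C ⊆ ⋃ Seen
      notEasy⇒C⊆⋃Seen notEasy {x} x∈C with notEasy⇒exit notEasy x∈C
      ... | u , xu with image-complete (∈-allFin x) xu
      ...   | k , refl = x∈⋃⁺ (Any.tabulate⁺ k (x∈p∩q⁺ (adj⇒∈N ux , x∈C)))
        where
          ux : adj G (image k) x ≡ true
          ux = trans (Graph.sym G (image k) x) (proj₂ (proj₂ (exit-sound xu)))

      maxSeen : ℕ
      maxSeen = max 0 (List.map ∣_∣ Seen)

      ∣C∣≤size*maxSeen : ¬ Easy G C → ∣ C ∣ ≤ size * maxSeen
      ∣C∣≤size*maxSeen notEasy = begin
          ∣ C ∣                 ≤⟨ p⊆q⇒∣p∣≤∣q∣ (notEasy⇒C⊆⋃Seen notEasy) ⟩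
          ∣ ⋃ Seen ∣            ≤⟨ ∣⋃ps∣≤length*b (All.map⁻ (xs≤max 0 (List.map ∣_∣ Seen))) ⟩
          length Seen * maxSeen ≡⟨ cong (_* maxSeen) (length-tabulate seen) ⟩
          size * maxSeen        ∎
        where open ≤-Reasoning

    module _ {Δ : ℕ} (2≤Δ : 2 ≤ Δ) (notEasy : ¬ Easy G C) (notDifficult : ¬ Difficult G Δ C)
             (large : LargeC G Δ C) where

      nonSpecial : ∀ {u} → u ∉ C → cube (2 * ∣ N G u ∩ C ∣) < Δ * Δ
      nonSpecial u∉C = ≰⇒> λ special → notDifficult (notEasy , (_ , u∉C , special) , large)

      notDifficult⇒largeMatching : Σ ℕ λ m → BipMatching G (NC G C ∩ ∁ C) C m × Δ ≤ cube m
      notDifficult⇒largeMatching = size , transversal⇒matching E , Δ≤m*b⇒Δ≤m³ size (2 * B) Δ≤size*2B 2B³<Δ²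
        where
          E = transversal exit _≟ᶠ_ (allFin n)
          open Transversal E using (size)
          B = maxSeen E
          Δ≤size*2B : Δ ≤ size * (2 * B)
          Δ≤size*2B = begin
              Δ                  ≤⟨ large⇒Δ≤2*c ∣ C ∣ 2≤Δ large ⟩
              2 * ∣ C ∣          ≤⟨ *-monoʳ-≤ 2 (∣C∣≤size*maxSeen E notEasy) ⟩
              2 * (size * B)     ≡⟨ sym (*-assoc 2 size B) ⟩
              2 * size * B       ≡⟨ cong (_* B) (*-comm 2 size) ⟩
              size * 2 * B       ≡⟨ *-assoc size 2 B ⟩
              size * (2 * B)     ∎
            where open ≤-Reasoning
          2B³<Δ² : cube (2 * B) < Δ * Δ
          2B³<Δ² = argmax-all id {P = λ b → cube (2 * b) < Δ * Δ}
            (*-mono-≤ 1≤Δ 1≤Δ) (All.map⁺ (All.tabulate⁺ λ k → nonSpecial (image-outside E k)))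
            where
              1≤Δ : 1 ≤ Δ
              1≤Δ = ≤-trans (s≤s z≤n) 2≤Δ

open import Defs hiding (sym)
open import Data.Nat using (ℕ; _≤_; _*_; suc)
open import Data.Nat.Properties using (*-identityˡ)
open import Data.Rational using (ℚ; 0ℚ; _<_; _/_)
open import Data.Integer using (+_)
open import Data.Fin using (Fin)
open import Data.Fin.Subset using (_∩_; ∁)
open import Data.Product using (Σ; _×_; _,_)
open import Data.Sum using (inj₁)
open import Relation.Binary.PropositionalEquality using (subst; sym)
open OrdinaryMatching using (notDifficult⇒largeMatching)

mainTheorem7 : (cs : ℚ) → 0ℚ < cs →
    (ε : ℚ) → 0ℚ < ε → ε < (+ 1) / 20 →
    Σ ℕ λ k → Σ ℕ λ Δ₀ →
    (n : ℕ) (G : Graph n) (Δ : ℕ) → Δ₀ ≤ Δ → MaxDegree G Δ →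
    (D : ACD G Δ ε cs) (pick : Fin (ACD.t D) → Fin n) → Picking G D pick →
    (j : Fin (ACD.t D)) → Ordinary G D pick j → LargeC G Δ (ACD.Cl D j) →
    Σ ℕ λ m → BipMatching G (NC G (ACD.Cl D j) ∩ ∁ (ACD.Cl D j)) (ACD.Cl D j) m
    × Δ ≤ (suc k * m) * (suc k * m) * (suc k * m)
mainTheorem7 _ _ _ _ _ = 0 , 2 , λ n G Δ 2≤Δ _ D pick _ j (notDifficult , notNice) large →
  let notEasy = λ easy → notNice (inj₁ easy)
      (m , matching , Δ≤m³) = notDifficult⇒largeMatching G (ACD.Cl D j) 2≤Δ notEasy notDifficult large
  in m , matching , subst (λ z → Δ ≤ z * z * z) (sym (*-identityˡ m)) Δ≤m³
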